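{- Let $Y$ be uniformly distributed on $[0,1]$ and let $k$ be a positive integer. Then \[ \frac{1}{k!}\big(\log^{Y}(1+t)\big)^{k}=\sum_{n=k}^{\infty}S_{1}^{Y}(n,k)\frac{t^{n}}{n!} =k\sum_{n=k}^{\infty}\frac{2^{n}}{n}\binom{n}{k}\sum_{j_1+\cdots+j_n=n-k}\binom{n-k}{j_1,\dots,j_n}A_{2,j_1}A_{2,j_2}\cdots A_{2,j_n}\frac{t^{n}}{n!}, \] the inner sum ranging over tuples of nonnegative integers.
   Context: For $Y\sim U[0,1]$, $E[e^{tY}]=\frac{e^t-1}{t}$. The probabilistic logarithm $\log^{Y}(1+t)$ is the compositional inverse of the delta series $E[e^{tY}]-1=\frac{e^t-1}{t}-1$, and the probabilistic Stirling numbers of the first kind $S_{1}^{Y}(n,k)$ are defined by $\frac1{k!}\big(\log^{Y}(1+t)\big)^k=\sum_{n\ge k}S_{1}^{Y}(n,k)\frac{t^n}{n!}$. The numbers $A_{2,n}$ are defined by $\frac{\frac{1}{2}t^{2}}{e^{t}-1-t}=\sum_{n\ge0}A_{2,n}\frac{t^{n}}{n!}$. -}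

module Defs where

open import Data.Nat.Base using (ℕ; zero; suc; _∸_; _^_; _!; _≤ᵇ_)
import Data.Nat.Base as ℕ
open import Data.Nat.Properties using (_!≢0)
open import Data.Nat.Combinatorics using (_C_)
open import Data.Integer.Base using (+_)
open import Data.Rational.Base using (ℚ; _/_; _+_; _*_; 0ℚ; 1ℚ)
open import Data.Bool.Base using (if_then_else_)
open import Data.List.Base using (List; []; _∷_; [_]; map; concatMap; upTo)
open import Data.Vec.Base using (Vec; []; _∷_)
import Data.Vec.Base as Vec
open import Data.Product.Base using (_×_)
open import Relation.Binary.PropositionalEquality using (_≡_)

ℕ→ℚ : ℕ → ℚ
ℕ→ℚ n = (+ n) / 1

invFact : ℕ → ℚ
invFact n = ((+ 1) / (n !)) {{n !≢0}}

sumUpTo : ℕ → (ℕ → ℚ) → ℚ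
sumUpTo zero    f = f 0
sumUpTo (suc n) f = sumUpTo n f + f (suc n)

sumList : List ℚ → ℚ
sumList []       = 0ℚ
sumList (x ∷ xs) = x + sumList xs

prodVec : ∀ {n} → Vec ℚ n → ℚ
prodVec []       = 1ℚ
prodVec (x ∷ xs) = x * prodVec xs

-- Formal power series over ℚ, given by their (ordinary) coefficients:
-- a : PS represents Σ_n a n t^n.

PS : Set
PS = ℕ → ℚ

_⊛_ : PS → PS → PS
(a ⊛ b) n = sumUpTo n (λ i → a i * b (n ∸ i))

oneS : PS
oneS zero    = 1ℚ
oneS (suc _) = 0ℚ

tS : PS
tS 1 = 1ℚ
tS _ = 0ℚ

powS : PS → ℕ → PS
powS a zero    = oneS
powS a (suc k) = a ⊛ powS a k

-- composition f(g(t)) for g with zero constant term: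
-- [t^n] f(g) = Σ_{m=0}^{n} f_m [t^n] g^m
composeS : PS → PS → PS
composeS f g n = sumUpTo n (λ m → f m * powS g m n)

-- Y ~ U[0,1]:  E[e^{tY}] - 1 = (e^t - 1)/t - 1 = Σ_{m ≥ 1} t^m/(m+1)!
deltaY : PS
deltaY zero    = 0ℚ
deltaY (suc m) = invFact (suc (suc m))

-- g is the probabilistic logarithm log^Y(1+t): the compositional inverse
-- of deltaY, i.e. g(0) = 0 and deltaY(g(t)) = t.
IsProbLog : PS → Set
IsProbLog g = (g 0 ≡ 0ℚ) × (∀ n → composeS deltaY g n ≡ tS n)

-- S_1^Y(n,k) for the probabilistic logarithm g:
-- (1/k!) g(t)^k = Σ_n S_1^Y(n,k) t^n / n!
S1Y : PS → ℕ → ℕ → ℚ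
S1Y g n k = ℕ→ℚ (n !) * powS g k n * invFact k

-- A_{2,n}:  (t^2/2) / (e^t - 1 - t) = Σ_n A_{2,n} t^n / n!,
-- characterised by (e^t - 1 - t) · Σ_n A_{2,n} t^n/n! = t^2/2.

expMinus1MinusT : PS
expMinus1MinusT zero          = 0ℚ
expMinus1MinusT (suc zero)    = 0ℚ
expMinus1MinusT (suc (suc n)) = invFact (suc (suc n))

halfTSq : PS
halfTSq 2 = (+ 1) / 2
halfTSq _ = 0ℚ

egf : (ℕ → ℚ) → PS
egf a n = a n * invFact n

IsA2 : (ℕ → ℚ) → Set
IsA2 A = ∀ n → (expMinus1MinusT ⊛ egf A) n ≡ halfTSq n

tuples : (p m : ℕ) → List (Vec ℕ p)
tuples zero    zero    = [ [] ]
tuples zero    (suc m) = []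
tuples (suc p) m       =
  concatMap (λ j → map (j ∷_) (tuples p (m ∸ j))) (upTo (suc m))

multinomial : ∀ {p} → ℕ → Vec ℕ p → ℚ
multinomial m js = ℕ→ℚ (m !) * prodVec (Vec.map invFact js)

innerSum : (ℕ → ℚ) → (p m : ℕ) → ℚ
innerSum A p m =
  sumList (map (λ js → multinomial m js * prodVec (Vec.map A js)) (tuples p m))

rhsCoeff : (ℕ → ℚ) → ℕ → ℕ → ℚ
rhsCoeff A k zero    = 0ℚ
rhsCoeff A k (suc n) =
  if k ≤ᵇ suc n
  then ℕ→ℚ k * ((+ (2 ^ suc n)) / suc n) * ℕ→ℚ (suc n C k)
         * innerSum A (suc n) (suc n ∸ k)
  else 0ℚ

-- Put D(t) = E[e^{tY}] − 1 = Σ_{m ≥ 1} t^m/(m+1)! and a(t) = Σ A_{2,n} tⁿ/n!.  Since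
-- e^t − 1 − t = t·D(t), the definition of A_{2,n} says D·φ = t for φ = 2a, so Lagrange inversion
-- for the compositional inverse g = log^Y(1+t) of D gives n [tⁿ] gᵏ = k [t^{n−k}] φⁿ
-- = k 2ⁿ [t^{n−k}] aⁿ, and [t^m] aⁿ is the multinomial sum over tuples divided by m!.
--
-- Lagrange inversion is proved by linear algebra.  Let M_{jk} = [t^k] Dʲ; it is lower triangular
-- with diagonal (D₁)ʲ ≠ 0.  Substituting g into Dʲ gives Σ_k M_{jk} · n [tⁿ] gᵏ = n [tⁿ] tʲ,
-- while differentiating Dʲ φʲ = tʲ shows Σ_k M_{jk} · k [t^{n−k}] φⁿ = [t^{n−1}] (Dʲ)′ φⁿ
-- = n [tⁿ] tʲ as well, so the two vectors coincide.

module Submission where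

open import Defs
open import Data.Nat.Base using (ℕ; _≤_)
open import Data.Rational.Base using (ℚ)
open import Relation.Binary.PropositionalEquality using (_≡_)

open import Algebra.Bundles using (CommutativeMonoid)
import Algebra.Properties.CommutativeSemigroup as CommutativeSemigroupProperties
import Algebra.Properties.Group as GroupProperties
open import Data.Bool.Base using (true; false)
open import Data.Empty using (⊥-elim)
import Data.Integer.Base as ℤ
import Data.Integer.Properties as ℤ
open import Data.List.Base using (List; []; _∷_; _++_; map; concatMap; applyUpTo; upTo)
import Data.List.Properties as List
open import Data.Nat.Base as ℕ using (zero; suc; _∸_; _<_; z≤n; s≤s; NonZero; _!; _^_)
open import Data.Nat.Combinatorics using (_C_; nCk≡n!/k![n-k]!; k![n∸k]!∣n!)
open import Data.Nat.DivMod using (m/n*n≡m)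
import Data.Nat.Properties as ℕ
open import Data.Product.Base using (_,_)
open import Data.Rational.Base as ℚ using (_+_; _*_; 0ℚ; 1ℚ; _/_; 1/_; toℚᵘ; fromℚᵘ; ≢-nonZero)
import Data.Rational.Properties as ℚ
open import Data.Rational.Solver using (module +-*-Solver)
open import Data.Rational.Unnormalised.Base as ℚᵘ using (mkℚᵘ; *≡*)
import Data.Rational.Unnormalised.Properties as ℚᵘ
open import Data.Sum.Base using (_⊎_; inj₁; inj₂; [_,_]′)
open import Data.Unit.Base using (tt)
open import Data.Vec.Base as Vec using (Vec; []; _∷_)
open import Function.Base using (_∘_)
open import Level using (0ℓ)
open import Relation.Binary.Bundles using (Setoid)
open import Relation.Binary.Definitions using (tri<; tri≈; tri>)
open import Relation.Binary.PropositionalEquality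
  using (_≢_; refl; sym; trans; cong; cong₂; subst; _≗_; _→-setoid_; module ≡-Reasoning)
import Relation.Binary.Reasoning.Setoid
open import Relation.Nullary using (yes; no)

open GroupProperties ℚ.+-0-group
  using () renaming (∙-cancelʳ to +-cancelʳ; identityˡ-unique to +-identityˡ-unique)
open CommutativeSemigroupProperties (CommutativeMonoid.commutativeSemigroup ℚ.+-0-commutativeMonoid)
  using () renaming (interchange to +-interchange)
open CommutativeSemigroupProperties (CommutativeMonoid.commutativeSemigroup ℚ.*-1-commutativeMonoid)
  using () renaming (x∙yz≈y∙xz to *-leftComm; interchange to *-interchange)

*-cancelˡ-≢0 : ∀ {p x y} → p ≢ 0ℚ → p * x ≡ p * y → x ≡ y
*-cancelˡ-≢0 {p} {x} {y} p≢0 px≡py = begin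
  x                ≡⟨ ℚ.*-identityˡ x ⟨
  1ℚ * x           ≡⟨ cong (_* x) (ℚ.*-inverseˡ p) ⟨
  (1/ p * p) * x   ≡⟨ ℚ.*-assoc (1/ p) p x ⟩
  1/ p * (p * x)   ≡⟨ cong (1/ p *_) px≡py ⟩
  1/ p * (p * y)   ≡⟨ ℚ.*-assoc (1/ p) p y ⟨
  (1/ p * p) * y   ≡⟨ cong (_* y) (ℚ.*-inverseˡ p) ⟩
  1ℚ * y           ≡⟨ ℚ.*-identityˡ y ⟩
  y                ∎
  where
  open ≡-Reasoning
  instance _ = ≢-nonZero p≢0

*-≢0 : ∀ {p q} → p ≢ 0ℚ → q ≢ 0ℚ → p * q ≢ 0ℚ
*-≢0 {p} p≢0 q≢0 pq≡0 = q≢0 (*-cancelˡ-≢0 p≢0 (trans pq≡0 (sym (ℚ.*-zeroʳ p))))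

fromℚᵘ-homo-+ : ∀ x y → fromℚᵘ (x ℚᵘ.+ y) ≡ fromℚᵘ x + fromℚᵘ y
fromℚᵘ-homo-+ x y = ℚ.toℚᵘ-injective (begin
  toℚᵘ (fromℚᵘ (x ℚᵘ.+ y))               ≈⟨ ℚ.toℚᵘ-fromℚᵘ (x ℚᵘ.+ y) ⟩
  x ℚᵘ.+ y                                ≈⟨ ℚᵘ.+-cong (ℚᵘ.≃-sym (ℚ.toℚᵘ-fromℚᵘ x))
                                                       (ℚᵘ.≃-sym (ℚ.toℚᵘ-fromℚᵘ y)) ⟩
  toℚᵘ (fromℚᵘ x) ℚᵘ.+ toℚᵘ (fromℚᵘ y)   ≈⟨ ℚ.toℚᵘ-homo-+ (fromℚᵘ x) (fromℚᵘ y) ⟨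
  toℚᵘ (fromℚᵘ x + fromℚᵘ y)              ∎)
  where open ℚᵘ.≃-Reasoning

fromℚᵘ-homo-* : ∀ x y → fromℚᵘ (x ℚᵘ.* y) ≡ fromℚᵘ x * fromℚᵘ y
fromℚᵘ-homo-* x y = ℚ.toℚᵘ-injective (begin
  toℚᵘ (fromℚᵘ (x ℚᵘ.* y))               ≈⟨ ℚ.toℚᵘ-fromℚᵘ (x ℚᵘ.* y) ⟩
  x ℚᵘ.* y                                ≈⟨ ℚᵘ.*-cong (ℚᵘ.≃-sym (ℚ.toℚᵘ-fromℚᵘ x))
                                                       (ℚᵘ.≃-sym (ℚ.toℚᵘ-fromℚᵘ y)) ⟩
  toℚᵘ (fromℚᵘ x) ℚᵘ.* toℚᵘ (fromℚᵘ y)   ≈⟨ ℚ.toℚᵘ-homo-* (fromℚᵘ x) (fromℚᵘ y) ⟨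
  toℚᵘ (fromℚᵘ x * fromℚᵘ y)              ∎)
  where open ℚᵘ.≃-Reasoning

-- ℕ→ℚ n is definitionally fromℚᵘ (mkℚᵘ (ℤ.+ n) 0).

ℕ→ℚ-+ : ∀ m n → ℕ→ℚ (m ℕ.+ n) ≡ ℕ→ℚ m + ℕ→ℚ n
ℕ→ℚ-+ m n =
  trans (ℚ.fromℚᵘ-cong {mkℚᵘ (ℤ.+ (m ℕ.+ n)) 0} {m′ ℚᵘ.+ n′} (*≡* ↥≡)) (fromℚᵘ-homo-+ m′ n′)
  where
  m′ = mkℚᵘ (ℤ.+ m) 0
  n′ = mkℚᵘ (ℤ.+ n) 0
  ↥≡ : ℤ.+ (m ℕ.+ n) ℤ.* ℤ.+ 1 ≡ (ℤ.+ m ℤ.* ℤ.+ 1 ℤ.+ ℤ.+ n ℤ.* ℤ.+ 1) ℤ.* ℤ.+ 1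
  ↥≡ rewrite ℤ.*-identityʳ (ℤ.+ m) | ℤ.*-identityʳ (ℤ.+ n) = cong (ℤ._* ℤ.+ 1) (ℤ.pos-+ m n)

ℕ→ℚ-* : ∀ m n → ℕ→ℚ (m ℕ.* n) ≡ ℕ→ℚ m * ℕ→ℚ n
ℕ→ℚ-* m n =
  trans (ℚ.fromℚᵘ-cong {mkℚᵘ (ℤ.+ (m ℕ.* n)) 0} {m′ ℚᵘ.* n′} (*≡* ↥≡)) (fromℚᵘ-homo-* m′ n′)
  where
  m′ = mkℚᵘ (ℤ.+ m) 0
  n′ = mkℚᵘ (ℤ.+ n) 0
  ↥≡ : ℤ.+ (m ℕ.* n) ℤ.* ℤ.+ 1 ≡ (ℤ.+ m ℤ.* ℤ.+ n) ℤ.* ℤ.+ 1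
  ↥≡ = cong (ℤ._* ℤ.+ 1) (ℤ.pos-* m n)

[a/d]*d≡a : ∀ a d .{{_ : NonZero d}} → ((ℤ.+ a) / d) * ℕ→ℚ d ≡ ℕ→ℚ a
[a/d]*d≡a a d@(suc d-1) =
  trans (sym (fromℚᵘ-homo-* (mkℚᵘ (ℤ.+ a) d-1) (mkℚᵘ (ℤ.+ d) 0)))
        (ℚ.fromℚᵘ-cong {mkℚᵘ (ℤ.+ a) d-1 ℚᵘ.* mkℚᵘ (ℤ.+ d) 0} {mkℚᵘ (ℤ.+ a) 0} (*≡* ↥≡))
  where
  ↥≡ : (ℤ.+ a ℤ.* ℤ.+ d) ℤ.* ℤ.+ 1 ≡ ℤ.+ a ℤ.* ℤ.+ (d ℕ.* 1)
  ↥≡ = trans (ℤ.*-identityʳ _) (cong (λ d → ℤ.+ a ℤ.* ℤ.+ d) (sym (ℕ.*-identityʳ d)))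

ℕ→ℚ-suc≢0 : ∀ n → ℕ→ℚ (suc n) ≢ 0ℚ
ℕ→ℚ-suc≢0 n n+1≡0 = ℚ.1≢0 (begin
  1ℚ                                  ≡⟨ [a/d]*d≡a 1 (suc n) ⟨
  ((ℤ.+ 1) / suc n) * ℕ→ℚ (suc n)     ≡⟨ cong (((ℤ.+ 1) / suc n) *_) n+1≡0 ⟩
  ((ℤ.+ 1) / suc n) * 0ℚ              ≡⟨ ℚ.*-zeroʳ ((ℤ.+ 1) / suc n) ⟩
  0ℚ                                  ∎)
  where open ≡-Reasoning

n!*invFact[n]≡1 : ∀ n → ℕ→ℚ (n !) * invFact n ≡ 1ℚ
n!*invFact[n]≡1 n = trans (ℚ.*-comm (ℕ→ℚ (n !)) (invFact n)) ([a/d]*d≡a 1 (n !) {{n ℕ.!≢0}})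

ℕ→ℚ-C : ∀ {n k} → k ≤ n → ℕ→ℚ (n C k) ≡ ℕ→ℚ (n !) * invFact k * invFact (n ∸ k)
ℕ→ℚ-C {n} {k} k≤n = begin
  ℕ→ℚ (n C k)
    ≡⟨ trans (ℚ.*-identityʳ (ℕ→ℚ (n C k) * 1ℚ)) (ℚ.*-identityʳ (ℕ→ℚ (n C k))) ⟨
  ℕ→ℚ (n C k) * 1ℚ * 1ℚ
    ≡⟨ cong₂ (λ x y → ℕ→ℚ (n C k) * x * y) (n!*invFact[n]≡1 k) (n!*invFact[n]≡1 (n ∸ k)) ⟨
  ℕ→ℚ (n C k) * (ℕ→ℚ (k !) * invFact k) * (ℕ→ℚ ((n ∸ k) !) * invFact (n ∸ k))
    ≡⟨ solve 5 (λ c a a⁻¹ b b⁻¹ → c :* (a :* a⁻¹) :* (b :* b⁻¹) := c :* (a :* b) :* a⁻¹ :* b⁻¹)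
             refl (ℕ→ℚ (n C k)) (ℕ→ℚ (k !)) (invFact k) (ℕ→ℚ ((n ∸ k) !)) (invFact (n ∸ k)) ⟩
  ℕ→ℚ (n C k) * (ℕ→ℚ (k !) * ℕ→ℚ ((n ∸ k) !)) * invFact k * invFact (n ∸ k)
    ≡⟨ cong (λ x → x * invFact k * invFact (n ∸ k))
            (trans (ℕ→ℚ-* (n C k) (k ! ℕ.* (n ∸ k) !))
                   (cong (ℕ→ℚ (n C k) *_) (ℕ→ℚ-* (k !) ((n ∸ k) !)))) ⟨
  ℕ→ℚ ((n C k) ℕ.* (k ! ℕ.* (n ∸ k) !)) * invFact k * invFact (n ∸ k)
    ≡⟨ cong (λ x → ℕ→ℚ x * invFact k * invFact (n ∸ k)) nCk*k!*[n∸k]!≡n! ⟩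
  ℕ→ℚ (n !) * invFact k * invFact (n ∸ k) ∎
  where
  open ≡-Reasoning
  open +-*-Solver
  nCk*k!*[n∸k]!≡n! : (n C k) ℕ.* (k ! ℕ.* (n ∸ k) !) ≡ n !
  nCk*k!*[n∸k]!≡n! = trans (cong (ℕ._* (k ! ℕ.* (n ∸ k) !)) (nCk≡n!/k![n-k]! k≤n))
                           (m/n*n≡m {{ℕ._!*_!≢0 k (n ∸ k)}} (k![n∸k]!∣n! k≤n))

sumUpTo-cong : ∀ n {f g : ℕ → ℚ} → (∀ i → i ≤ n → f i ≡ g i) → sumUpTo n f ≡ sumUpTo n g
sumUpTo-cong zero    f≡g = f≡g 0 z≤n
sumUpTo-cong (suc n) f≡g =
  cong₂ _+_ (sumUpTo-cong n (λ i i≤n → f≡g i (ℕ.m≤n⇒m≤1+n i≤n))) (f≡g (suc n) ℕ.≤-refl)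

sumUpTo-zero : ∀ n {f : ℕ → ℚ} → (∀ i → i ≤ n → f i ≡ 0ℚ) → sumUpTo n f ≡ 0ℚ
sumUpTo-zero zero    f≡0 = f≡0 0 z≤n
sumUpTo-zero (suc n) f≡0 =
  cong₂ _+_ (sumUpTo-zero n (λ i i≤n → f≡0 i (ℕ.m≤n⇒m≤1+n i≤n))) (f≡0 (suc n) ℕ.≤-refl)

sumUpTo-+ : ∀ n (f g : ℕ → ℚ) → sumUpTo n (λ i → f i + g i) ≡ sumUpTo n f + sumUpTo n g
sumUpTo-+ zero    f g = refl
sumUpTo-+ (suc n) f g = trans (cong (_+ (f (suc n) + g (suc n))) (sumUpTo-+ n f g))
  (+-interchange (sumUpTo n f) (sumUpTo n g) (f (suc n)) (g (suc n)))

*-distribˡ-sumUpTo : ∀ c n (f : ℕ → ℚ) → c * sumUpTo n f ≡ sumUpTo n (λ i → c * f i)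
*-distribˡ-sumUpTo c zero    f = refl
*-distribˡ-sumUpTo c (suc n) f = trans (ℚ.*-distribˡ-+ c (sumUpTo n f) (f (suc n)))
  (cong (_+ c * f (suc n)) (*-distribˡ-sumUpTo c n f))

*-distribʳ-sumUpTo : ∀ c n (f : ℕ → ℚ) → sumUpTo n f * c ≡ sumUpTo n (λ i → f i * c)
*-distribʳ-sumUpTo c n f = trans (ℚ.*-comm (sumUpTo n f) c)
  (trans (*-distribˡ-sumUpTo c n f) (sumUpTo-cong n (λ i _ → ℚ.*-comm c (f i))))

sumUpTo-suc : ∀ n (f : ℕ → ℚ) → sumUpTo (suc n) f ≡ f 0 + sumUpTo n (f ∘ suc)
sumUpTo-suc zero    f = refl
sumUpTo-suc (suc n) f = trans (cong (_+ f (suc (suc n))) (sumUpTo-suc n f))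
  (ℚ.+-assoc (f 0) (sumUpTo n (f ∘ suc)) (f (suc (suc n))))

sumUpTo-reverse : ∀ n (f : ℕ → ℚ) → sumUpTo n f ≡ sumUpTo n (λ i → f (n ∸ i))
sumUpTo-reverse zero    f = refl
sumUpTo-reverse (suc n) f = begin
  sumUpTo (suc n) f
    ≡⟨ sumUpTo-suc n f ⟩
  f 0 + sumUpTo n (f ∘ suc)
    ≡⟨ cong (f 0 +_) (sumUpTo-reverse n (f ∘ suc)) ⟩
  f 0 + sumUpTo n (λ i → f (suc (n ∸ i)))
    ≡⟨ ℚ.+-comm (f 0) _ ⟩
  sumUpTo n (λ i → f (suc (n ∸ i))) + f 0
    ≡⟨ cong₂ _+_ (sumUpTo-cong n λ i i≤n → cong f (sym (ℕ.+-∸-assoc 1 i≤n)))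
                 (cong f (sym (ℕ.n∸n≡0 (suc n)))) ⟩
  sumUpTo (suc n) (λ i → f (suc n ∸ i)) ∎
  where open ≡-Reasoning

sumUpTo-comm : ∀ n m (F : ℕ → ℕ → ℚ) →
               sumUpTo n (λ i → sumUpTo m (F i)) ≡ sumUpTo m (λ j → sumUpTo n (λ i → F i j))
sumUpTo-comm zero    m F = refl
sumUpTo-comm (suc n) m F = trans (cong (_+ sumUpTo m (F (suc n))) (sumUpTo-comm n m F))
  (sym (sumUpTo-+ m (λ j → sumUpTo n (λ i → F i j)) (F (suc n))))

sumUpTo-triangle : ∀ n (F : ℕ → ℕ → ℚ) →
  sumUpTo n (λ m → sumUpTo m (λ i → F i (m ∸ i))) ≡ sumUpTo n (λ i → sumUpTo (n ∸ i) (F i))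
sumUpTo-triangle zero    F = refl
sumUpTo-triangle (suc n) F = begin
  sumUpTo n (λ m → sumUpTo m (λ i → F i (m ∸ i))) + sumUpTo (suc n) (λ i → F i (suc n ∸ i))
    ≡⟨ cong (_+ sumUpTo (suc n) (λ i → F i (suc n ∸ i))) (sumUpTo-triangle n F) ⟩
  Σ-rows + (sumUpTo n (λ i → F i (suc n ∸ i)) + F (suc n) (n ∸ n))
    ≡⟨ ℚ.+-assoc Σ-rows (sumUpTo n (λ i → F i (suc n ∸ i))) (F (suc n) (n ∸ n)) ⟨
  (Σ-rows + sumUpTo n (λ i → F i (suc n ∸ i))) + F (suc n) (n ∸ n)
    ≡⟨ cong (_+ F (suc n) (n ∸ n))
            (sumUpTo-+ n (λ i → sumUpTo (n ∸ i) (F i)) (λ i → F i (suc n ∸ i))) ⟨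
  sumUpTo n (λ i → sumUpTo (n ∸ i) (F i) + F i (suc n ∸ i)) + F (suc n) (n ∸ n)
    ≡⟨ cong₂ _+_ (sumUpTo-cong n extendRow) (lastRow (n ∸ n) (ℕ.n∸n≡0 n)) ⟩
  sumUpTo (suc n) (λ i → sumUpTo (suc n ∸ i) (F i)) ∎
  where
  open ≡-Reasoning
  Σ-rows = sumUpTo n (λ i → sumUpTo (n ∸ i) (F i))
  extendRow : ∀ i → i ≤ n → sumUpTo (n ∸ i) (F i) + F i (suc n ∸ i) ≡ sumUpTo (suc n ∸ i) (F i)
  extendRow i i≤n rewrite ℕ.+-∸-assoc 1 i≤n = refl
  lastRow : ∀ l → l ≡ 0 → F (suc n) l ≡ sumUpTo l (F (suc n))
  lastRow _ refl = refl

sumUpTo-extend : ∀ {l N} (f : ℕ → ℚ) → l ≤ N → (∀ j → l < j → j ≤ N → f j ≡ 0ℚ) →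
                 sumUpTo N f ≡ sumUpTo l f
sumUpTo-extend {N = zero}  f z≤n f≡0 = refl
sumUpTo-extend {N = suc N} f l≤N f≡0 with ℕ.m≤n⇒m<n∨m≡n l≤N
... | inj₂ refl       = refl
... | inj₁ (s≤s l≤N′) = trans
  (cong₂ _+_ (sumUpTo-extend f l≤N′ λ j l<j j≤N → f≡0 j l<j (ℕ.m≤n⇒m≤1+n j≤N))
             (f≡0 (suc N) (s≤s l≤N′) ℕ.≤-refl))
  (ℚ.+-identityʳ _)

sumUpTo-single : ∀ {n} j (f : ℕ → ℚ) → j ≤ n → (∀ i → i ≤ n → i ≢ j → f i ≡ 0ℚ) →
                 sumUpTo n f ≡ f j
sumUpTo-single j f j≤n f≡0 = trans
  (sumUpTo-extend f j≤n λ i j<i i≤n → f≡0 i i≤n (ℕ.>⇒≢ j<i))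
  (lastOnly j λ i i<j → f≡0 i (ℕ.<⇒≤ (ℕ.<-≤-trans i<j j≤n)) (ℕ.<⇒≢ i<j))
  where
  lastOnly : ∀ j → (∀ i → i < j → f i ≡ 0ℚ) → sumUpTo j f ≡ f j
  lastOnly zero    _   = refl
  lastOnly (suc j) f≡0 =
    trans (cong (_+ f (suc j)) (sumUpTo-zero j λ i i≤j → f≡0 i (s≤s i≤j))) (ℚ.+-identityˡ (f (suc j)))

sumList-++ : ∀ xs ys → sumList (xs ++ ys) ≡ sumList xs + sumList ys
sumList-++ []       ys = sym (ℚ.+-identityˡ (sumList ys))
sumList-++ (x ∷ xs) ys = trans (cong (x +_) (sumList-++ xs ys)) (sym (ℚ.+-assoc x (sumList xs) (sumList ys)))

sumList-map-concatMap : ∀ {A B : Set} (f : B → ℚ) (G : A → List B) xs →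
  sumList (map f (concatMap G xs)) ≡ sumList (map (λ x → sumList (map f (G x))) xs)
sumList-map-concatMap f G []       = refl
sumList-map-concatMap f G (x ∷ xs) = begin
  sumList (map f (G x ++ concatMap G xs))
    ≡⟨ cong sumList (List.map-++ f (G x) (concatMap G xs)) ⟩
  sumList (map f (G x) ++ map f (concatMap G xs))
    ≡⟨ sumList-++ (map f (G x)) (map f (concatMap G xs)) ⟩
  sumList (map f (G x)) + sumList (map f (concatMap G xs))
    ≡⟨ cong (sumList (map f (G x)) +_) (sumList-map-concatMap f G xs) ⟩
  sumList (map f (G x)) + sumList (map (λ x → sumList (map f (G x))) xs) ∎
  where open ≡-Reasoning

sumList-map-applyUpTo : ∀ (f : ℕ → ℚ) h m → sumList (map f (applyUpTo h (suc m))) ≡ sumUpTo m (f ∘ h)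
sumList-map-applyUpTo f h zero    = ℚ.+-identityʳ (f (h 0))
sumList-map-applyUpTo f h (suc m) =
  trans (cong (f (h 0) +_) (sumList-map-applyUpTo f (h ∘ suc) m)) (sym (sumUpTo-suc m (f ∘ h)))

*-distribˡ-sumList : ∀ c xs → c * sumList xs ≡ sumList (map (c *_) xs)
*-distribˡ-sumList c []       = ℚ.*-zeroʳ c
*-distribˡ-sumList c (x ∷ xs) =
  trans (ℚ.*-distribˡ-+ c x (sumList xs)) (cong (c * x +_) (*-distribˡ-sumList c xs))

*-distribʳ-sumList : ∀ c xs → sumList xs * c ≡ sumList (map (_* c) xs)
*-distribʳ-sumList c xs = trans (ℚ.*-comm (sumList xs) c)
  (trans (*-distribˡ-sumList c xs) (cong sumList (List.map-cong (λ x → ℚ.*-comm c x) xs)))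

prodVec-map-* : ∀ {p} (f g : ℕ → ℚ) (js : Vec ℕ p) →
  prodVec (Vec.map f js) * prodVec (Vec.map g js) ≡ prodVec (Vec.map (λ j → f j * g j) js)
prodVec-map-* f g []       = refl
prodVec-map-* f g (j ∷ js) =
  trans (*-interchange (f j) (prodVec (Vec.map f js)) (g j) (prodVec (Vec.map g js)))
        (cong (f j * g j *_) (prodVec-map-* f g js))

-- The ring of formal power series

infixl 6 _⊕_
infixr 7 _•_

_⊕_ : PS → PS → PS
(a ⊕ b) n = a n + b n

_•_ : ℚ → PS → PS
(c • a) n = c * a n

module ≗-Reasoning = Relation.Binary.Reasoning.Setoid (ℕ →-setoid ℚ)

⊛-cong : ∀ {a a′ b b′} → a ≗ a′ → b ≗ b′ → a ⊛ b ≗ a′ ⊛ b′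
⊛-cong a≗a′ b≗b′ n = sumUpTo-cong n λ i _ → cong₂ _*_ (a≗a′ i) (b≗b′ (n ∸ i))

⊛-congˡ : ∀ {a a′} b → a ≗ a′ → a ⊛ b ≗ a′ ⊛ b
⊛-congˡ {a} {a′} b a≗a′ = ⊛-cong {a} {a′} {b} {b} a≗a′ (λ _ → refl)

⊛-congʳ : ∀ a {b b′} → b ≗ b′ → a ⊛ b ≗ a ⊛ b′
⊛-congʳ a {b} {b′} b≗b′ = ⊛-cong {a} {a} {b} {b′} (λ _ → refl) b≗b′

⊛-comm : ∀ a b → a ⊛ b ≗ b ⊛ a
⊛-comm a b n = trans (sumUpTo-reverse n (λ i → a i * b (n ∸ i))) (sumUpTo-cong n λ i i≤n →
  trans (cong (λ j → a (n ∸ i) * b j) (ℕ.m∸[m∸n]≡n i≤n)) (ℚ.*-comm (a (n ∸ i)) (b i)))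

⊛-assoc : ∀ a b c → (a ⊛ b) ⊛ c ≗ a ⊛ (b ⊛ c)
⊛-assoc a b c n = begin
  sumUpTo n (λ m → sumUpTo m (λ i → a i * b (m ∸ i)) * c (n ∸ m))
    ≡⟨ sumUpTo-cong n (λ m _ → *-distribʳ-sumUpTo (c (n ∸ m)) m _) ⟩
  sumUpTo n (λ m → sumUpTo m (λ i → a i * b (m ∸ i) * c (n ∸ m)))
    ≡⟨ sumUpTo-cong n (λ m _ → sumUpTo-cong m (λ i i≤m → reindex m i i≤m)) ⟩
  sumUpTo n (λ m → sumUpTo m (λ i → F i (m ∸ i)))
    ≡⟨ sumUpTo-triangle n F ⟩
  sumUpTo n (λ i → sumUpTo (n ∸ i) (F i))
    ≡⟨ sumUpTo-cong n (λ i _ → *-distribˡ-sumUpTo (a i) (n ∸ i) _) ⟨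
  (a ⊛ (b ⊛ c)) n ∎
  where
  open ≡-Reasoning
  F : ℕ → ℕ → ℚ
  F i j = a i * (b j * c (n ∸ i ∸ j))
  reindex : ∀ m i → i ≤ m → a i * b (m ∸ i) * c (n ∸ m) ≡ F i (m ∸ i)
  reindex m i i≤m = trans (ℚ.*-assoc (a i) (b (m ∸ i)) (c (n ∸ m))) (cong (λ l → a i * (b (m ∸ i) * c l))
    (trans (cong (n ∸_) (sym (ℕ.m+[n∸m]≡n i≤m))) (sym (ℕ.∸-+-assoc n i (m ∸ i)))))

⊛-identityˡ : ∀ a → oneS ⊛ a ≗ a
⊛-identityˡ a n = trans (sumUpTo-single 0 _ z≤n oneS-off) (ℚ.*-identityˡ (a n))
  where
  oneS-off : ∀ i → i ≤ n → i ≢ 0 → oneS i * a (n ∸ i) ≡ 0ℚ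
  oneS-off zero    _ 0≢0 = ⊥-elim (0≢0 refl)
  oneS-off (suc i) _ _   = ℚ.*-zeroˡ (a (n ∸ suc i))

⊛-identityʳ : ∀ a → a ⊛ oneS ≗ a
⊛-identityʳ a n = trans (⊛-comm a oneS n) (⊛-identityˡ a n)

⊛-distribʳ-⊕ : ∀ a b c → (a ⊕ b) ⊛ c ≗ a ⊛ c ⊕ b ⊛ c
⊛-distribʳ-⊕ a b c n =
  trans (sumUpTo-cong n λ i _ → ℚ.*-distribʳ-+ (c (n ∸ i)) (a i) (b i)) (sumUpTo-+ n _ _)

•-⊛ : ∀ c a b → (c • a) ⊛ b ≗ c • (a ⊛ b)
•-⊛ c a b n = trans (sumUpTo-cong n λ i _ → ℚ.*-assoc c (a i) _) (sym (*-distribˡ-sumUpTo c n _))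

⊛-• : ∀ c a b → a ⊛ (c • b) ≗ c • (a ⊛ b)
⊛-• c a b n = trans (⊛-comm a (c • b) n) (trans (•-⊛ c b a n) (cong (c *_) (⊛-comm b a n)))

⊛-commutativeMonoid : CommutativeMonoid 0ℓ 0ℓ
⊛-commutativeMonoid = record
  { Carrier             = PS
  ; _≈_                 = _≗_
  ; _∙_                 = _⊛_
  ; ε                   = oneS
  ; isCommutativeMonoid = record
    { isMonoid = record
      { isSemigroup = record
        { isMagma = record
          { isEquivalence = Setoid.isEquivalence (ℕ →-setoid ℚ)
          ; ∙-cong        = ⊛-cong
          }
        ; assoc = ⊛-assoc
        }
      ; identity = ⊛-identityˡ , ⊛-identityʳ
      }
    ; comm = ⊛-comm
    }
  }

open CommutativeSemigroupProperties (CommutativeMonoid.commutativeSemigroup ⊛-commutativeMonoid)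
  using () renaming (interchange to ⊛-interchange; xy∙z≈xz∙y to ⊛-rightComm)

powS-cong : ∀ {a b} m → a ≗ b → powS a m ≗ powS b m
powS-cong zero    a≗b = λ _ → refl
powS-cong (suc m) a≗b = ⊛-cong a≗b (powS-cong m a≗b)

powS-+ : ∀ a i j → powS a (i ℕ.+ j) ≗ powS a i ⊛ powS a j
powS-+ a zero    j n = sym (⊛-identityˡ (powS a j) n)
powS-+ a (suc i) j n = trans (⊛-congʳ a (powS-+ a i j) n) (sym (⊛-assoc a (powS a i) (powS a j) n))

powS-⊛ : ∀ a b m → powS (a ⊛ b) m ≗ powS a m ⊛ powS b m
powS-⊛ a b zero    n = sym (⊛-identityˡ oneS n)
powS-⊛ a b (suc m) n =
  trans (⊛-congʳ (a ⊛ b) (powS-⊛ a b m) n) (⊛-interchange a b (powS a m) (powS b m) n)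

powS-• : ∀ c a m → powS (ℕ→ℚ c • a) m ≗ ℕ→ℚ (c ^ m) • powS a m
powS-• c a zero    n = sym (ℚ.*-identityˡ (oneS n))
powS-• c a (suc m) n = begin
  ((c′ • a) ⊛ powS (c′ • a) m) n              ≡⟨ ⊛-congʳ (c′ • a) (powS-• c a m) n ⟩
  ((c′ • a) ⊛ (ℕ→ℚ (c ^ m) • powS a m)) n    ≡⟨ •-⊛ c′ a (ℕ→ℚ (c ^ m) • powS a m) n ⟩
  c′ * (a ⊛ (ℕ→ℚ (c ^ m) • powS a m)) n     ≡⟨ cong (c′ *_) (⊛-• (ℕ→ℚ (c ^ m)) a (powS a m) n) ⟩
  c′ * (ℕ→ℚ (c ^ m) * powS a (suc m) n)     ≡⟨ ℚ.*-assoc c′ (ℕ→ℚ (c ^ m)) (powS a (suc m) n) ⟨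
  c′ * ℕ→ℚ (c ^ m) * powS a (suc m) n       ≡⟨ cong (_* powS a (suc m) n) (ℕ→ℚ-* c (c ^ m)) ⟨
  ℕ→ℚ (c ^ suc m) * powS a (suc m) n        ∎
  where
  open ≡-Reasoning
  c′ = ℕ→ℚ c

powS-regroup : ∀ e a b j s →
               (e ⊛ (powS a j ⊛ b)) ⊛ powS a (suc s) ≗ (e ⊛ powS a (suc j)) ⊛ (powS a s ⊛ b)
powS-regroup e a b j s = begin
  (e ⊛ (powS a j ⊛ b)) ⊛ powS a (suc s)   ≈⟨ ⊛-assoc e (powS a j ⊛ b) (powS a (suc s)) ⟩
  e ⊛ ((powS a j ⊛ b) ⊛ powS a (suc s))   ≈⟨ ⊛-congʳ e (⊛-rightComm (powS a j) b (powS a (suc s))) ⟩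
  e ⊛ ((powS a j ⊛ powS a (suc s)) ⊛ b)   ≈⟨ ⊛-congʳ e (⊛-congˡ b (powS-+ a j (suc s))) ⟨
  e ⊛ (powS a (j ℕ.+ suc s) ⊛ b)          ≡⟨ cong (λ m → e ⊛ (powS a m ⊛ b)) (ℕ.+-suc j s) ⟩
  e ⊛ (powS a (suc j ℕ.+ s) ⊛ b)          ≈⟨ ⊛-congʳ e (⊛-congˡ b (powS-+ a (suc j) s)) ⟩
  e ⊛ ((powS a (suc j) ⊛ powS a s) ⊛ b)   ≈⟨ ⊛-congʳ e (⊛-assoc (powS a (suc j)) (powS a s) b) ⟩
  e ⊛ (powS a (suc j) ⊛ (powS a s ⊛ b))   ≈⟨ ⊛-assoc e (powS a (suc j)) (powS a s ⊛ b) ⟨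
  (e ⊛ powS a (suc j)) ⊛ (powS a s ⊛ b)   ∎
  where open ≗-Reasoning

powS-as-sum-over-tuples : ∀ a p m → powS a p m ≡ sumList (map (prodVec ∘ Vec.map a) (tuples p m))
powS-as-sum-over-tuples a zero    zero    = refl
powS-as-sum-over-tuples a zero    (suc m) = refl
powS-as-sum-over-tuples a (suc p) m = sym (begin
  sumList (map w (concatMap G (upTo (suc m))))
    ≡⟨ sumList-map-concatMap w G (upTo (suc m)) ⟩
  sumList (map (λ j → sumList (map w (G j))) (upTo (suc m)))
    ≡⟨ sumList-map-applyUpTo (λ j → sumList (map w (G j))) (λ j → j) m ⟩
  sumUpTo m (λ j → sumList (map w (G j)))
    ≡⟨ sumUpTo-cong m (λ j _ → cong sumList (sym (List.map-∘ (tuples p (m ∸ j))))) ⟩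
  sumUpTo m (λ j → sumList (map (λ js → a j * w js) (tuples p (m ∸ j))))
    ≡⟨ sumUpTo-cong m (λ j _ → cong sumList (List.map-∘ {g = a j *_} {f = w} (tuples p (m ∸ j)))) ⟩
  sumUpTo m (λ j → sumList (map (a j *_) (map w (tuples p (m ∸ j)))))
    ≡⟨ sumUpTo-cong m (λ j _ → *-distribˡ-sumList (a j) (map w (tuples p (m ∸ j)))) ⟨
  sumUpTo m (λ j → a j * sumList (map w (tuples p (m ∸ j))))
    ≡⟨ sumUpTo-cong m (λ j _ → cong (a j *_) (powS-as-sum-over-tuples a p (m ∸ j))) ⟨
  powS a (suc p) m ∎)
  where
  open ≡-Reasoning
  w : ∀ {q} → Vec ℕ q → ℚ
  w = prodVec ∘ Vec.map a
  G : ℕ → List (Vec ℕ (suc p))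
  G j = map (j ∷_) (tuples p (m ∸ j))

_vanishesBelow_ : PS → ℕ → Set
a vanishesBelow m = ∀ n → n < m → a n ≡ 0ℚ

vanishesBelow-1 : ∀ a → a 0 ≡ 0ℚ → a vanishesBelow 1
vanishesBelow-1 a a0≡0 zero    _         = a0≡0
vanishesBelow-1 a a0≡0 (suc n) (s≤s ())

module _ (a b : PS) {i j : ℕ} (a<i : a vanishesBelow i) (b<j : b vanishesBelow j) where

  private
    term-vanishes : ∀ n l → l ≤ n → l < i ⊎ n < l ℕ.+ j → a l * b (n ∸ l) ≡ 0ℚ
    term-vanishes n l l≤n (inj₁ l<i)   = trans (cong (_* b (n ∸ l)) (a<i l l<i)) (ℚ.*-zeroˡ (b (n ∸ l)))
    term-vanishes n l l≤n (inj₂ n<l+j) = trans (cong (a l *_) (b<j (n ∸ l) n∸l<j)) (ℚ.*-zeroʳ (a l))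
      where
      n∸l<j : n ∸ l < j
      n∸l<j = ℕ.+-cancelˡ-< l (n ∸ l) j (subst (_< l ℕ.+ j) (sym (ℕ.m+[n∸m]≡n l≤n)) n<l+j)

  ⊛-vanishesBelow : (a ⊛ b) vanishesBelow (i ℕ.+ j)
  ⊛-vanishesBelow n n<i+j = sumUpTo-zero n λ l l≤n → term-vanishes n l l≤n (case l)
    where
    case : ∀ l → l < i ⊎ n < l ℕ.+ j
    case l with l ℕ.<? i
    ... | yes l<i = inj₁ l<i
    ... | no  l≮i = inj₂ (ℕ.<-≤-trans n<i+j (ℕ.+-monoˡ-≤ j (ℕ.≮⇒≥ l≮i)))

  ⊛-leading : (a ⊛ b) (i ℕ.+ j) ≡ a i * b j
  ⊛-leading = trans
    (sumUpTo-single i _ (ℕ.m≤m+n i j) λ l l≤i+j l≢i → term-vanishes (i ℕ.+ j) l l≤i+j (case l l≢i))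
    (cong (λ m → a i * b m) (ℕ.m+n∸m≡n i j))
    where
    case : ∀ l → l ≢ i → l < i ⊎ i ℕ.+ j < l ℕ.+ j
    case l l≢i with ℕ.<-cmp l i
    ... | tri< l<i _ _ = inj₁ l<i
    ... | tri≈ _ l≡i _ = ⊥-elim (l≢i l≡i)
    ... | tri> _ _ l>i = inj₂ (ℕ.+-monoˡ-< j l>i)

powS-vanishesBelow : ∀ a → a 0 ≡ 0ℚ → ∀ m → powS a m vanishesBelow m
powS-vanishesBelow a a0≡0 zero    = λ _ ()
powS-vanishesBelow a a0≡0 (suc m) =
  ⊛-vanishesBelow a (powS a m) (vanishesBelow-1 a a0≡0) (powS-vanishesBelow a a0≡0 m)

powS-diagonal-≢0 : ∀ a → a 0 ≡ 0ℚ → a 1 ≢ 0ℚ → ∀ m → powS a m m ≢ 0ℚ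
powS-diagonal-≢0 a a0≡0 a1≢0 zero    ()
powS-diagonal-≢0 a a0≡0 a1≢0 (suc m) =
  subst (_≢ 0ℚ) (sym (⊛-leading a (powS a m) (vanishesBelow-1 a a0≡0) (powS-vanishesBelow a a0≡0 m)))
        (*-≢0 a1≢0 (powS-diagonal-≢0 a a0≡0 a1≢0 m))

tS-⊛-suc : ∀ b i → (tS ⊛ b) (suc i) ≡ b i
tS-⊛-suc b i = trans (sumUpTo-single 1 _ (s≤s z≤n) tS-off) (ℚ.*-identityˡ (b i))
  where
  tS-off : ∀ l → l ≤ suc i → l ≢ 1 → tS l * b (suc i ∸ l) ≡ 0ℚ
  tS-off zero          _ _   = ℚ.*-zeroˡ (b (suc i))
  tS-off (suc zero)    _ 1≢1 = ⊥-elim (1≢1 refl)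
  tS-off (suc (suc l)) _ _   = ℚ.*-zeroˡ (b (i ∸ suc l))

powS-tS-⊛ : ∀ m b j → (powS tS m ⊛ b) (m ℕ.+ j) ≡ b j
powS-tS-⊛ zero    b j = ⊛-identityˡ b j
powS-tS-⊛ (suc m) b j = begin
  ((tS ⊛ powS tS m) ⊛ b) (suc m ℕ.+ j)  ≡⟨ ⊛-assoc tS (powS tS m) b (suc (m ℕ.+ j)) ⟩
  (tS ⊛ (powS tS m ⊛ b)) (suc m ℕ.+ j)  ≡⟨ tS-⊛-suc (powS tS m ⊛ b) (m ℕ.+ j) ⟩
  (powS tS m ⊛ b) (m ℕ.+ j)             ≡⟨ powS-tS-⊛ m b j ⟩
  b j                                   ∎
  where open ≡-Reasoning

powS-tS-above : ∀ {m n} → m < n → powS tS m n ≡ 0ℚ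
powS-tS-above {m} m<n with ℕ.m≤n⇒∃[o]m+o≡n m<n
... | s , refl = trans (sym (⊛-identityʳ (powS tS m) (suc (m ℕ.+ s))))
                       (subst (λ l → (powS tS m ⊛ oneS) l ≡ 0ℚ) (ℕ.+-suc m s) (powS-tS-⊛ m oneS (suc s)))

-- Formal derivative

∂ : PS → PS
∂ a n = ℕ→ℚ (suc n) * a (suc n)

∂-cong : ∀ {a b} → a ≗ b → ∂ a ≗ ∂ b
∂-cong a≗b n = cong (ℕ→ℚ (suc n) *_) (a≗b (suc n))

∂-powS-vanishesBelow : ∀ a → a 0 ≡ 0ℚ → ∀ j → ∂ (powS a (suc j)) vanishesBelow j
∂-powS-vanishesBelow a a0≡0 j n n<j = trans
  (cong (ℕ→ℚ (suc n) *_) (powS-vanishesBelow a a0≡0 (suc j) (suc n) (s≤s n<j)))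
  (ℚ.*-zeroʳ (ℕ→ℚ (suc n)))

∂-⊛ : ∀ a b → ∂ (a ⊛ b) ≗ ∂ a ⊛ b ⊕ a ⊛ ∂ b
∂-⊛ a b n = begin
  ℕ→ℚ (suc n) * sumUpTo (suc n) (λ i → a i * b (suc n ∸ i))
    ≡⟨ *-distribˡ-sumUpTo (ℕ→ℚ (suc n)) (suc n) _ ⟩
  sumUpTo (suc n) (λ i → ℕ→ℚ (suc n) * (a i * b (suc n ∸ i)))
    ≡⟨ sumUpTo-cong (suc n) split ⟩
  sumUpTo (suc n) (λ i → X i + Y i)
    ≡⟨ sumUpTo-+ (suc n) X Y ⟩
  sumUpTo (suc n) X + sumUpTo (suc n) Y
    ≡⟨ cong₂ _+_ ΣX ΣY ⟩
  (∂ a ⊛ b) n + (a ⊛ ∂ b) n ∎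
  where
  open ≡-Reasoning
  X Y : ℕ → ℚ
  X i = ℕ→ℚ i * (a i * b (suc n ∸ i))
  Y i = ℕ→ℚ (suc n ∸ i) * (a i * b (suc n ∸ i))
  split : ∀ i → i ≤ suc n → ℕ→ℚ (suc n) * (a i * b (suc n ∸ i)) ≡ X i + Y i
  split i i≤n+1 = trans (cong (λ m → ℕ→ℚ m * (a i * b (suc n ∸ i))) (sym (ℕ.m+[n∸m]≡n i≤n+1)))
    (trans (cong (_* (a i * b (suc n ∸ i))) (ℕ→ℚ-+ i (suc n ∸ i)))
           (ℚ.*-distribʳ-+ (a i * b (suc n ∸ i)) (ℕ→ℚ i) (ℕ→ℚ (suc n ∸ i))))
  ΣX : sumUpTo (suc n) X ≡ (∂ a ⊛ b) n
  ΣX = begin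
    sumUpTo (suc n) X
      ≡⟨ sumUpTo-suc n X ⟩
    X 0 + sumUpTo n (X ∘ suc)
      ≡⟨ cong (_+ sumUpTo n (X ∘ suc)) (ℚ.*-zeroˡ (a 0 * b (suc n))) ⟩
    0ℚ + sumUpTo n (X ∘ suc)
      ≡⟨ ℚ.+-identityˡ (sumUpTo n (X ∘ suc)) ⟩
    sumUpTo n (X ∘ suc)
      ≡⟨ sumUpTo-cong n (λ i _ → ℚ.*-assoc (ℕ→ℚ (suc i)) (a (suc i)) (b (n ∸ i))) ⟨
    (∂ a ⊛ b) n ∎
  ΣY : sumUpTo (suc n) Y ≡ (a ⊛ ∂ b) n
  ΣY = begin
    sumUpTo n Y + Y (suc n)           ≡⟨ cong₂ _+_ (sumUpTo-cong n Yᵢ) Yₙ₊₁ ⟩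
    (a ⊛ ∂ b) n + 0ℚ                  ≡⟨ ℚ.+-identityʳ ((a ⊛ ∂ b) n) ⟩
    (a ⊛ ∂ b) n                       ∎
    where
    Yᵢ : ∀ i → i ≤ n → Y i ≡ a i * ∂ b (n ∸ i)
    Yᵢ i i≤n rewrite ℕ.+-∸-assoc 1 i≤n = *-leftComm (ℕ→ℚ (suc (n ∸ i))) (a i) (b (suc (n ∸ i)))
    Yₙ₊₁ : Y (suc n) ≡ 0ℚ
    Yₙ₊₁ = trans (cong (λ m → ℕ→ℚ m * (a (suc n) * b (n ∸ n))) (ℕ.n∸n≡0 n))
                 (ℚ.*-zeroˡ (a (suc n) * b (n ∸ n)))

∂-powS : ∀ a r → ∂ (powS a (suc r)) ≗ ℕ→ℚ (suc r) • (powS a r ⊛ ∂ a)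
∂-powS a zero    n = trans (∂-cong (⊛-identityʳ a) n)
                           (sym (trans (ℚ.*-identityˡ ((oneS ⊛ ∂ a) n)) (⊛-identityˡ (∂ a) n)))
∂-powS a (suc r) n = begin
  ∂ (a ⊛ P) n                    ≡⟨ ∂-⊛ a P n ⟩
  (∂ a ⊛ P) n + (a ⊛ ∂ P) n      ≡⟨ cong₂ _+_ (⊛-comm (∂ a) P n) (⊛-congʳ a (∂-powS a r) n) ⟩
  x + (a ⊛ (k • (Q ⊛ ∂ a))) n    ≡⟨ cong (x +_) (⊛-• k a (Q ⊛ ∂ a) n) ⟩
  x + k * (a ⊛ (Q ⊛ ∂ a)) n      ≡⟨ cong (λ y → x + k * y) (⊛-assoc a Q (∂ a) n) ⟨
  x + k * x                      ≡⟨ cong (_+ k * x) (ℚ.*-identityˡ x) ⟨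
  1ℚ * x + k * x                 ≡⟨ ℚ.*-distribʳ-+ x 1ℚ k ⟨
  (1ℚ + k) * x                   ≡⟨ cong (_* x) (ℕ→ℚ-+ 1 (suc r)) ⟨
  ℕ→ℚ (suc (suc r)) * x          ∎
  where
  open ≡-Reasoning
  P = powS a (suc r)
  Q = powS a r
  k = ℕ→ℚ (suc r)
  x = (P ⊛ ∂ a) n

∂-tS : ∂ tS ≗ oneS
∂-tS zero    = refl
∂-tS (suc n) = ℚ.*-zeroʳ (ℕ→ℚ (suc (suc n)))

∂-powS-tS : ∀ r → ∂ (powS tS (suc r)) ≗ ℕ→ℚ (suc r) • powS tS r
∂-powS-tS r n = trans (∂-powS tS r n)
  (cong (ℕ→ℚ (suc r) *_) (trans (⊛-congʳ (powS tS r) ∂-tS n) (⊛-identityʳ (powS tS r) n)))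

∂-⊛-as-sumUpTo : ∀ b c n → (∂ b ⊛ c) n ≡ sumUpTo (suc n) (λ k → b k * (ℕ→ℚ k * c (suc n ∸ k)))
∂-⊛-as-sumUpTo b c n = sym (begin
  sumUpTo (suc n) (λ k → b k * (ℕ→ℚ k * c (suc n ∸ k)))
    ≡⟨ sumUpTo-suc n _ ⟩
  b 0 * (0ℚ * c (suc n)) + sumUpTo n (λ i → b (suc i) * (ℕ→ℚ (suc i) * c (n ∸ i)))
    ≡⟨ cong (_+ sumUpTo n (λ i → b (suc i) * (ℕ→ℚ (suc i) * c (n ∸ i))))
            (trans (cong (b 0 *_) (ℚ.*-zeroˡ (c (suc n)))) (ℚ.*-zeroʳ (b 0))) ⟩
  0ℚ + sumUpTo n (λ i → b (suc i) * (ℕ→ℚ (suc i) * c (n ∸ i)))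
    ≡⟨ ℚ.+-identityˡ _ ⟩
  sumUpTo n (λ i → b (suc i) * (ℕ→ℚ (suc i) * c (n ∸ i)))
    ≡⟨ sumUpTo-cong n (λ i _ → trans (*-leftComm (b (suc i)) (ℕ→ℚ (suc i)) (c (n ∸ i)))
                                       (sym (ℚ.*-assoc (ℕ→ℚ (suc i)) (b (suc i)) (c (n ∸ i))))) ⟩
  (∂ b ⊛ c) n ∎)
  where open ≡-Reasoning

-- Composition

composeS-extend : ∀ f g → g 0 ≡ 0ℚ → ∀ {n N} → n ≤ N →
                  composeS f g n ≡ sumUpTo N (λ m → f m * powS g m n)
composeS-extend f g g0≡0 {n} n≤N = sym (sumUpTo-extend _ n≤N λ m n<m _ →
  trans (cong (f m *_) (powS-vanishesBelow g g0≡0 m n n<m)) (ℚ.*-zeroʳ (f m)))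

composeS-oneS : ∀ g → composeS oneS g ≗ oneS
composeS-oneS g n = trans (sumUpTo-single 0 _ z≤n oneS-off) (ℚ.*-identityˡ (oneS n))
  where
  oneS-off : ∀ i → i ≤ n → i ≢ 0 → oneS i * powS g i n ≡ 0ℚ
  oneS-off zero    _ 0≢0 = ⊥-elim (0≢0 refl)
  oneS-off (suc i) _ _   = ℚ.*-zeroˡ (powS g (suc i) n)

composeS-⊛ : ∀ g → g 0 ≡ 0ℚ → ∀ a b → composeS (a ⊛ b) g ≗ composeS a g ⊛ composeS b g
composeS-⊛ g g0≡0 a b n = trans left≡doubleSum (sym right≡doubleSum)
  where
  open ≡-Reasoning
  G : ℕ → ℕ → ℚ
  G m = powS g m
  F : ℕ → ℕ → ℚ
  F i j = (a i * b j) * G (i ℕ.+ j) n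
  doubleSum = sumUpTo n (λ i → sumUpTo n (F i))

  left≡doubleSum : composeS (a ⊛ b) g n ≡ doubleSum
  left≡doubleSum = begin
    sumUpTo n (λ m → (a ⊛ b) m * G m n)
      ≡⟨ sumUpTo-cong n (λ m _ → *-distribʳ-sumUpTo (G m n) m _) ⟩
    sumUpTo n (λ m → sumUpTo m (λ i → a i * b (m ∸ i) * G m n))
      ≡⟨ sumUpTo-cong n (λ m _ → sumUpTo-cong m λ i i≤m →
           cong (λ l → a i * b (m ∸ i) * G l n) (sym (ℕ.m+[n∸m]≡n i≤m))) ⟩
    sumUpTo n (λ m → sumUpTo m (λ i → F i (m ∸ i)))
      ≡⟨ sumUpTo-triangle n F ⟩
    sumUpTo n (λ i → sumUpTo (n ∸ i) (F i))
      ≡⟨ sumUpTo-cong n (λ i i≤n → sym (sumUpTo-extend (F i) (ℕ.m∸n≤m n i) (F-vanishes i i≤n))) ⟩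
    doubleSum ∎
    where
    F-vanishes : ∀ i → i ≤ n → ∀ j → n ∸ i < j → j ≤ n → F i j ≡ 0ℚ
    F-vanishes i i≤n j n∸i<j _ = trans (cong ((a i * b j) *_) (powS-vanishesBelow g g0≡0 (i ℕ.+ j) n
      (subst (_< i ℕ.+ j) (ℕ.m+[n∸m]≡n i≤n) (ℕ.+-monoʳ-< i n∸i<j)))) (ℚ.*-zeroʳ (a i * b j))

  right≡doubleSum : (composeS a g ⊛ composeS b g) n ≡ doubleSum
  right≡doubleSum = begin
    sumUpTo n (λ l → composeS a g l * composeS b g (n ∸ l))
      ≡⟨ sumUpTo-cong n (λ l l≤n → cong₂ _*_ (composeS-extend a g g0≡0 l≤n)
                                            (composeS-extend b g g0≡0 (ℕ.m∸n≤m n l))) ⟩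
    sumUpTo n (λ l → sumUpTo n (λ i → a i * G i l) * sumUpTo n (λ j → b j * G j (n ∸ l)))
      ≡⟨ sumUpTo-cong n (λ l _ → trans (*-distribʳ-sumUpTo _ n _)
                                       (sumUpTo-cong n λ i _ → *-distribˡ-sumUpTo (a i * G i l) n _)) ⟩
    sumUpTo n (λ l → sumUpTo n (λ i → sumUpTo n (λ j → T l i j)))
      ≡⟨ sumUpTo-comm n n (λ l i → sumUpTo n (T l i)) ⟩
    sumUpTo n (λ i → sumUpTo n (λ l → sumUpTo n (λ j → T l i j)))
      ≡⟨ sumUpTo-cong n (λ i _ → sumUpTo-comm n n (λ l j → T l i j)) ⟩
    sumUpTo n (λ i → sumUpTo n (λ j → sumUpTo n (λ l → T l i j)))
      ≡⟨ sumUpTo-cong n (λ i _ → sumUpTo-cong n λ j _ → Σ-T≡F i j) ⟩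
    doubleSum ∎
    where
    T : ℕ → ℕ → ℕ → ℚ
    T l i j = (a i * G i l) * (b j * G j (n ∸ l))
    Σ-T≡F : ∀ i j → sumUpTo n (λ l → T l i j) ≡ F i j
    Σ-T≡F i j = begin
      sumUpTo n (λ l → T l i j)
        ≡⟨ sumUpTo-cong n (λ l _ → *-interchange (a i) (G i l) (b j) (G j (n ∸ l))) ⟩
      sumUpTo n (λ l → (a i * b j) * (G i l * G j (n ∸ l)))
        ≡⟨ *-distribˡ-sumUpTo (a i * b j) n _ ⟨
      (a i * b j) * (powS g i ⊛ powS g j) n
        ≡⟨ cong ((a i * b j) *_) (powS-+ g i j n) ⟨
      F i j ∎

composeS-powS : ∀ g → g 0 ≡ 0ℚ → ∀ a j → composeS (powS a j) g ≗ powS (composeS a g) j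
composeS-powS g g0≡0 a zero      = composeS-oneS g
composeS-powS g g0≡0 a (suc j) n = trans (composeS-⊛ g g0≡0 a (powS a j) n)
  (⊛-congʳ (composeS a g) (composeS-powS g g0≡0 a j) n)

-- Lagrange inversion

lowerTriangular-unique : (M : ℕ → ℕ → ℚ) → (∀ j k → k < j → M j k ≡ 0ℚ) → (∀ j → M j j ≢ 0ℚ) →
  ∀ n (x y : ℕ → ℚ) →
  (∀ j → 1 ≤ j → j ≤ n → sumUpTo n (λ k → M j k * x k) ≡ sumUpTo n (λ k → M j k * y k)) →
  ∀ k → 1 ≤ k → k ≤ n → x k ≡ y k
lowerTriangular-unique M lower diag zero    x y Mx≡My k 1≤k k≤0 =
  ⊥-elim (ℕ.<-irrefl refl (ℕ.≤-trans 1≤k k≤0))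
lowerTriangular-unique M lower diag (suc n) x y Mx≡My k 1≤k k≤n+1 =
  [ below , (λ { refl → xₙ₊₁≡yₙ₊₁ }) ]′ (ℕ.m≤n⇒m<n∨m≡n k≤n+1)
  where
  lastRow : ∀ z → sumUpTo (suc n) (λ k → M (suc n) k * z k) ≡ M (suc n) (suc n) * z (suc n)
  lastRow z = trans (cong (_+ M (suc n) (suc n) * z (suc n)) (sumUpTo-zero n λ k k≤n →
      trans (cong (_* z k) (lower (suc n) k (s≤s k≤n))) (ℚ.*-zeroˡ (z k))))
    (ℚ.+-identityˡ (M (suc n) (suc n) * z (suc n)))
  xₙ₊₁≡yₙ₊₁ : x (suc n) ≡ y (suc n)
  xₙ₊₁≡yₙ₊₁ = *-cancelˡ-≢0 (diag (suc n))
    (trans (sym (lastRow x)) (trans (Mx≡My (suc n) (s≤s z≤n) ℕ.≤-refl) (lastRow y)))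
  upperRows : ∀ j → 1 ≤ j → j ≤ n → sumUpTo n (λ k → M j k * x k) ≡ sumUpTo n (λ k → M j k * y k)
  upperRows j 1≤j j≤n = +-cancelʳ (M j (suc n) * x (suc n)) _ _
    (trans (Mx≡My j 1≤j (ℕ.m≤n⇒m≤1+n j≤n))
           (cong (λ z → sumUpTo n (λ k → M j k * y k) + M j (suc n) * z) (sym xₙ₊₁≡yₙ₊₁)))
  below : k < suc n → x k ≡ y k
  below (s≤s k≤n) = lowerTriangular-unique M lower diag n x y upperRows k 1≤k k≤n

module _ (D φ : PS) (D0≡0 : D 0 ≡ 0ℚ) (Dφ≗t : D ⊛ φ ≗ tS) where

  private
    E Φ : ℕ → PS
    E = powS D
    Φ = powS φ

  Dʲ⊛φʲ≗tʲ : ∀ j → E j ⊛ Φ j ≗ powS tS j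
  Dʲ⊛φʲ≗tʲ j n = trans (sym (powS-⊛ D φ j n)) (powS-cong j Dφ≗t n)

  ∂-Dʲ⊛φʲ : ∀ j → ∂ (E j) ⊛ Φ j ⊕ E j ⊛ ∂ (Φ j) ≗ ∂ (powS tS j)
  ∂-Dʲ⊛φʲ j n = trans (sym (∂-⊛ (E j) (Φ j) n)) (∂-cong (Dʲ⊛φʲ≗tʲ j) n)

  residue-above : ∀ j n → n < j → (∂ (E (suc j)) ⊛ Φ (suc n)) n ≡ ∂ (powS tS (suc j)) n
  residue-above j n n<j = trans
    (⊛-vanishesBelow (∂ (E (suc j))) (Φ (suc n)) (∂-powS-vanishesBelow D D0≡0 j) (λ _ ())
                     n (subst (n <_) (sym (ℕ.+-identityʳ j)) n<j))
    (sym (∂-powS-vanishesBelow tS refl j n n<j))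

  residue-diagonal : ∀ n → (∂ (E (suc n)) ⊛ Φ (suc n)) n ≡ ∂ (powS tS (suc n)) n
  residue-diagonal n = begin
    (∂ (E N) ⊛ Φ N) n                          ≡⟨ ℚ.+-identityʳ ((∂ (E N) ⊛ Φ N) n) ⟨
    (∂ (E N) ⊛ Φ N) n + 0ℚ                     ≡⟨ cong ((∂ (E N) ⊛ Φ N) n +_) E⊛∂Φ≡0 ⟨
    (∂ (E N) ⊛ Φ N) n + (E N ⊛ ∂ (Φ N)) n      ≡⟨ ∂-Dʲ⊛φʲ N n ⟩
    ∂ (powS tS N) n                            ∎
    where
    open ≡-Reasoning
    N = suc n
    E⊛∂Φ≡0 : (E N ⊛ ∂ (Φ N)) n ≡ 0ℚ
    E⊛∂Φ≡0 = ⊛-vanishesBelow (E N) (∂ (Φ N)) (powS-vanishesBelow D D0≡0 N) (λ _ ())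
               n (subst (n <_) (sym (ℕ.+-identityʳ N)) ℕ.≤-refl)

  -- With J = j + 1, r = s + 1 and Φ (J + r) = Φ J ⊛ Φ r, differentiating E J ⊛ Φ J = t^J gives
  -- P + Q = J [t^r] Φ r, and moving one factor φ from Φ J to Φ r gives r·Q = J·r [t^r] Φ r; so P = 0.
  residue-below : ∀ j s → (∂ (E (suc j)) ⊛ Φ (suc j ℕ.+ suc s)) (j ℕ.+ suc s) ≡ 0ℚ
  residue-below j s = *-cancelˡ-≢0 (ℕ→ℚ-suc≢0 s) (trans r*P≡0 (sym (ℚ.*-zeroʳ r)))
    where
    open ≡-Reasoning
    J = suc j
    n = j ℕ.+ suc s
    r = ℕ→ℚ (suc s)
    k = ℕ→ℚ J
    c = Φ (suc s) (suc s)
    P = (∂ (E J) ⊛ Φ (J ℕ.+ suc s)) n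
    Q = ((E J ⊛ ∂ (Φ J)) ⊛ Φ (suc s)) n
    X = (E J ⊛ (Φ j ⊛ ∂ φ)) ⊛ Φ (suc s)
    Y = (E J ⊛ Φ J) ⊛ (Φ s ⊛ ∂ φ)

    P+Q≡k*c : P + Q ≡ k * c
    P+Q≡k*c = begin
      P + Q
        ≡⟨ cong (_+ Q) (trans (⊛-congʳ (∂ (E J)) (powS-+ φ J (suc s)) n)
                              (sym (⊛-assoc (∂ (E J)) (Φ J) (Φ (suc s)) n))) ⟩
      ((∂ (E J) ⊛ Φ J) ⊛ Φ (suc s)) n + Q
        ≡⟨ ⊛-distribʳ-⊕ (∂ (E J) ⊛ Φ J) (E J ⊛ ∂ (Φ J)) (Φ (suc s)) n ⟨
      ((∂ (E J) ⊛ Φ J ⊕ E J ⊛ ∂ (Φ J)) ⊛ Φ (suc s)) n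
        ≡⟨ ⊛-congˡ (Φ (suc s)) (λ m → trans (∂-Dʲ⊛φʲ J m) (∂-powS-tS j m)) n ⟩
      ((k • powS tS j) ⊛ Φ (suc s)) n
        ≡⟨ •-⊛ k (powS tS j) (Φ (suc s)) n ⟩
      k * (powS tS j ⊛ Φ (suc s)) n
        ≡⟨ cong (k *_) (powS-tS-⊛ j (Φ (suc s)) (suc s)) ⟩
      k * c ∎

    r*Q≡k*[r*c] : r * Q ≡ k * (r * c)
    r*Q≡k*[r*c] = begin
      r * Q
        ≡⟨ cong (r *_) (trans (⊛-congˡ (Φ (suc s)) (⊛-congʳ (E J) (∂-powS φ j)) n)
                       (trans (⊛-congˡ (Φ (suc s)) (⊛-• k (E J) (Φ j ⊛ ∂ φ)) n)
                              (•-⊛ k (E J ⊛ (Φ j ⊛ ∂ φ)) (Φ (suc s)) n))) ⟩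
      r * (k * X n)
        ≡⟨ *-leftComm r k (X n) ⟩
      k * (r * X n)
        ≡⟨ cong (λ x → k * (r * x)) (powS-regroup (E J) φ (∂ φ) j s n) ⟩
      k * (r * Y n)
        ≡⟨ cong (k *_) (⊛-• r (E J ⊛ Φ J) (Φ s ⊛ ∂ φ) n) ⟨
      k * ((E J ⊛ Φ J) ⊛ (r • (Φ s ⊛ ∂ φ))) n
        ≡⟨ cong (k *_) (⊛-cong (Dʲ⊛φʲ≗tʲ J) (λ m → sym (∂-powS φ s m)) n) ⟩
      k * (powS tS J ⊛ ∂ (Φ (suc s))) n
        ≡⟨ cong (λ m → k * (powS tS J ⊛ ∂ (Φ (suc s))) m) (ℕ.+-suc j s) ⟩
      k * (powS tS J ⊛ ∂ (Φ (suc s))) (J ℕ.+ s)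
        ≡⟨ cong (k *_) (powS-tS-⊛ J (∂ (Φ (suc s))) s) ⟩
      k * (r * c) ∎

    r*P≡0 : r * P ≡ 0ℚ
    r*P≡0 = +-identityˡ-unique (r * P) (r * Q) (begin
      r * P + r * Q   ≡⟨ ℚ.*-distribˡ-+ r P Q ⟨
      r * (P + Q)     ≡⟨ cong (r *_) P+Q≡k*c ⟩
      r * (k * c)     ≡⟨ *-leftComm r k c ⟩
      k * (r * c)     ≡⟨ r*Q≡k*[r*c] ⟨
      r * Q           ∎)

  residue : ∀ j n → (∂ (E (suc j)) ⊛ Φ (suc n)) n ≡ ∂ (powS tS (suc j)) n
  residue j n with ℕ.<-cmp j n
  ... | tri> _ _ n<j  = residue-above j n n<j
  ... | tri≈ _ refl _ = residue-diagonal j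
  ... | tri< j<n _ _  with ℕ.m≤n⇒∃[o]m+o≡n j<n
  ...   | s , refl = trans
    (subst (λ m → (∂ (E (suc j)) ⊛ Φ (suc m)) m ≡ 0ℚ) (ℕ.+-suc j s) (residue-below j s))
    (sym (trans (cong (ℕ→ℚ (suc n) *_) (powS-tS-above (s≤s j<n))) (ℚ.*-zeroʳ (ℕ→ℚ (suc n)))))

lagrangeInversion : ∀ D φ g → D ⊛ φ ≗ tS → g 0 ≡ 0ℚ → composeS D g ≗ tS →
                    ∀ {k n} → 1 ≤ k → k ≤ n → ℕ→ℚ n * powS g k n ≡ ℕ→ℚ k * powS φ n (n ∸ k)
lagrangeInversion _ _ _ _ _ _ {n = zero} (s≤s z≤n) ()
lagrangeInversion D φ g Dφ≗t g0≡0 D∘g≗t {k} {suc n} 1≤k k≤n =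
  lowerTriangular-unique (powS D) (powS-vanishesBelow D D0≡0) (powS-diagonal-≢0 D D0≡0 D1≢0)
                         (suc n) _ _ rows k 1≤k k≤n
  where
  open ≡-Reasoning
  D0≡0 : D 0 ≡ 0ℚ
  D0≡0 = trans (sym (ℚ.*-identityʳ (D 0))) (D∘g≗t 0)
  D1≢0 : D 1 ≢ 0ℚ
  D1≢0 D1≡0 = ℚ.1≢0 (begin
    1ℚ              ≡⟨ Dφ≗t 1 ⟨
    (D ⊛ φ) 1       ≡⟨ ⊛-leading D φ (vanishesBelow-1 D D0≡0) (λ _ ()) ⟩
    D 1 * φ 0       ≡⟨ cong (_* φ 0) D1≡0 ⟩
    0ℚ * φ 0        ≡⟨ ℚ.*-zeroˡ (φ 0) ⟩
    0ℚ              ∎)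
  N = suc n
  rows : ∀ j → 1 ≤ j → j ≤ N →
         sumUpTo N (λ m → powS D j m * (ℕ→ℚ N * powS g m N))
         ≡ sumUpTo N (λ m → powS D j m * (ℕ→ℚ m * powS φ N (N ∸ m)))
  rows (suc j) _ _ = begin
    sumUpTo N (λ m → powS D (suc j) m * (ℕ→ℚ N * powS g m N))
      ≡⟨ sumUpTo-cong N (λ m _ → *-leftComm (powS D (suc j) m) (ℕ→ℚ N) (powS g m N)) ⟩
    sumUpTo N (λ m → ℕ→ℚ N * (powS D (suc j) m * powS g m N))
      ≡⟨ *-distribˡ-sumUpTo (ℕ→ℚ N) N _ ⟨
    ℕ→ℚ N * composeS (powS D (suc j)) g N
      ≡⟨ cong (ℕ→ℚ N *_) (trans (composeS-powS g g0≡0 D (suc j) N) (powS-cong (suc j) D∘g≗t N)) ⟩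
    ∂ (powS tS (suc j)) n
      ≡⟨ residue D φ D0≡0 Dφ≗t j n ⟨
    (∂ (powS D (suc j)) ⊛ powS φ N) n
      ≡⟨ ∂-⊛-as-sumUpTo (powS D (suc j)) (powS φ N) n ⟩
    sumUpTo N (λ m → powS D (suc j) m * (ℕ→ℚ m * powS φ N (N ∸ m))) ∎

-- The probabilistic Stirling numbers

innerSum-as-powS-egf : ∀ A p m → innerSum A p m * invFact m ≡ powS (egf A) p m
innerSum-as-powS-egf A p m = begin
  sumList (map term (tuples p m)) * invFact m
    ≡⟨ *-distribʳ-sumList (invFact m) (map term (tuples p m)) ⟩
  sumList (map (_* invFact m) (map term (tuples p m)))
    ≡⟨ cong sumList (List.map-∘ (tuples p m)) ⟨
  sumList (map (λ js → term js * invFact m) (tuples p m))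
    ≡⟨ cong sumList (List.map-cong term*invFact (tuples p m)) ⟩
  sumList (map (prodVec ∘ Vec.map (egf A)) (tuples p m))
    ≡⟨ powS-as-sum-over-tuples (egf A) p m ⟨
  powS (egf A) p m ∎
  where
  open ≡-Reasoning
  term : Vec ℕ p → ℚ
  term js = multinomial m js * prodVec (Vec.map A js)
  term*invFact : ∀ js → term js * invFact m ≡ prodVec (Vec.map (egf A) js)
  term*invFact js = begin
    ℕ→ℚ (m !) * Πf * ΠA * invFact m     ≡⟨ solve 4 (λ f x y i → f :* x :* y :* i := y :* x :* (f :* i))
                                                   refl (ℕ→ℚ (m !)) Πf ΠA (invFact m) ⟩
    ΠA * Πf * (ℕ→ℚ (m !) * invFact m)   ≡⟨ cong (ΠA * Πf *_) (n!*invFact[n]≡1 m) ⟩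
    ΠA * Πf * 1ℚ                        ≡⟨ ℚ.*-identityʳ (ΠA * Πf) ⟩
    ΠA * Πf                             ≡⟨ prodVec-map-* A invFact js ⟩
    prodVec (Vec.map (egf A) js)        ∎
    where
    open +-*-Solver
    Πf = prodVec (Vec.map invFact js)
    ΠA = prodVec (Vec.map A js)

expMinus1MinusT≗tS⊛deltaY : expMinus1MinusT ≗ tS ⊛ deltaY
expMinus1MinusT≗tS⊛deltaY zero    = refl
expMinus1MinusT≗tS⊛deltaY (suc n) = trans (shift n) (sym (tS-⊛-suc deltaY n))
  where
  shift : ∀ n → expMinus1MinusT (suc n) ≡ deltaY n
  shift zero    = refl
  shift (suc n) = refl

deltaY⊛2egf≗tS : ∀ A → IsA2 A → deltaY ⊛ (ℕ→ℚ 2 • egf A) ≗ tS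
deltaY⊛2egf≗tS A isA2 n = begin
  (deltaY ⊛ (two • egf A)) n              ≡⟨ ⊛-• two deltaY (egf A) n ⟩
  two * (deltaY ⊛ egf A) n                ≡⟨ cong (two *_) (tS-⊛-suc (deltaY ⊛ egf A) n) ⟨
  two * (tS ⊛ (deltaY ⊛ egf A)) (suc n)   ≡⟨ cong (two *_) (⊛-assoc tS deltaY (egf A) (suc n)) ⟨
  two * ((tS ⊛ deltaY) ⊛ egf A) (suc n)   ≡⟨ cong (two *_) (⊛-congˡ (egf A) expMinus1MinusT≗tS⊛deltaY (suc n)) ⟨
  two * (expMinus1MinusT ⊛ egf A) (suc n) ≡⟨ cong (two *_) (isA2 (suc n)) ⟩
  two * halfTSq (suc n)                   ≡⟨ twice-halfTSq n ⟩
  tS n                                    ∎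
  where
  open ≡-Reasoning
  two = ℕ→ℚ 2
  twice-halfTSq : ∀ n → ℕ→ℚ 2 * halfTSq (suc n) ≡ tS n
  twice-halfTSq zero          = refl
  twice-halfTSq (suc zero)    = refl
  twice-halfTSq (suc (suc n)) = refl

probLog-powS-coeff : ∀ {g} → IsProbLog g → ∀ {A} → IsA2 A → ∀ {n k} → 1 ≤ k → k ≤ suc n →
  powS g k (suc n) ≡
  ℕ→ℚ k * ((ℤ.+ (2 ^ suc n)) / suc n) * (innerSum A (suc n) (suc n ∸ k) * invFact (suc n ∸ k))
probLog-powS-coeff {g} (g0≡0 , D∘g≗t) {A} isA2 {n} {k} 1≤k k≤N = *-cancelˡ-≢0 (ℕ→ℚ-suc≢0 n) (begin
  ℕ→ℚ N * powS g k N
    ≡⟨ lagrangeInversion deltaY (ℕ→ℚ 2 • egf A) g (deltaY⊛2egf≗tS A isA2) g0≡0 D∘g≗t 1≤k k≤N ⟩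
  K * powS (ℕ→ℚ 2 • egf A) N (N ∸ k)
    ≡⟨ cong (K *_) (powS-• 2 (egf A) N (N ∸ k)) ⟩
  K * (ℕ→ℚ (2 ^ N) * powS (egf A) N (N ∸ k))
    ≡⟨ cong (λ x → K * (ℕ→ℚ (2 ^ N) * x)) (innerSum-as-powS-egf A N (N ∸ k)) ⟨
  K * (ℕ→ℚ (2 ^ N) * X)
    ≡⟨ cong (λ x → K * (x * X)) ([a/d]*d≡a (2 ^ N) N) ⟨
  K * (B * ℕ→ℚ N * X)
    ≡⟨ solve 4 (λ K B N X → K :* (B :* N :* X) := N :* (K :* B :* X)) refl K B (ℕ→ℚ N) X ⟩
  ℕ→ℚ N * (K * B * X) ∎)
  where
  open ≡-Reasoning
  open +-*-Solver
  N = suc n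
  K = ℕ→ℚ k
  B = (ℤ.+ (2 ^ N)) / N
  X = innerSum A N (N ∸ k) * invFact (N ∸ k)

S1Y-closedForm : ∀ {g} → IsProbLog g → ∀ {A} → IsA2 A → ∀ {n k} → 1 ≤ k → k ≤ suc n →
  S1Y g (suc n) k ≡
  ℕ→ℚ k * ((ℤ.+ (2 ^ suc n)) / suc n) * ℕ→ℚ (suc n C k) * innerSum A (suc n) (suc n ∸ k)
S1Y-closedForm {g} isProbLog {A} isA2 {n} {k} 1≤k k≤N = begin
  ℕ→ℚ (N !) * powS g k N * invFact k
    ≡⟨ cong (λ x → ℕ→ℚ (N !) * x * invFact k) (probLog-powS-coeff isProbLog isA2 1≤k k≤N) ⟩
  ℕ→ℚ (N !) * (K * B * (I * invFact (N ∸ k))) * invFact k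
    ≡⟨ solve 6 (λ f i K B I h → f :* (K :* B :* (I :* h)) :* i := K :* B :* (f :* i :* h) :* I)
               refl (ℕ→ℚ (N !)) (invFact k) K B I (invFact (N ∸ k)) ⟩
  K * B * (ℕ→ℚ (N !) * invFact k * invFact (N ∸ k)) * I
    ≡⟨ cong (λ x → K * B * x * I) (ℕ→ℚ-C k≤N) ⟨
  K * B * ℕ→ℚ (N C k) * I ∎
  where
  open ≡-Reasoning
  open +-*-Solver
  N = suc n
  K = ℕ→ℚ k
  B = (ℤ.+ (2 ^ N)) / N
  I = innerSum A N (N ∸ k)

S1Y-above : ∀ g → g 0 ≡ 0ℚ → ∀ {n k} → n < k → S1Y g n k ≡ 0ℚ
S1Y-above g g0≡0 {n} {k} n<k = begin
  ℕ→ℚ (n !) * powS g k n * invFact k  ≡⟨ cong (λ x → ℕ→ℚ (n !) * x * invFact k)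
                                               (powS-vanishesBelow g g0≡0 k n n<k) ⟩
  ℕ→ℚ (n !) * 0ℚ * invFact k          ≡⟨ cong (_* invFact k) (ℚ.*-zeroʳ (ℕ→ℚ (n !))) ⟩
  0ℚ * invFact k                      ≡⟨ ℚ.*-zeroˡ (invFact k) ⟩
  0ℚ                                  ∎
  where open ≡-Reasoning

rhsCoeff-above : ∀ A {n k} → n < k → rhsCoeff A k n ≡ 0ℚ
rhsCoeff-above A {zero}      _   = refl
rhsCoeff-above A {suc n} {k} n<k with k ℕ.≤ᵇ suc n | ℕ.≤ᵇ⇒≤ k (suc n)
... | false | _   = refl
... | true  | k≤n = ⊥-elim (ℕ.<⇒≱ n<k (k≤n tt))

rhsCoeff-≤ : ∀ A {n k} → k ≤ suc n → rhsCoeff A k (suc n) ≡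
  ℕ→ℚ k * ((ℤ.+ (2 ^ suc n)) / suc n) * ℕ→ℚ (suc n C k) * innerSum A (suc n) (suc n ∸ k)
rhsCoeff-≤ A {n} {k} k≤n with k ℕ.≤ᵇ suc n | ℕ.≤⇒≤ᵇ k≤n
... | true | _ = refl

corollary5p3 : (g : PS) → IsProbLog g → (A : ℕ → ℚ) → IsA2 A →
    (k : ℕ) → 1 ≤ k → (n : ℕ) → S1Y g n k ≡ rhsCoeff A k n
corollary5p3 g isProbLog@(g0≡0 , _) A isA2 k@(suc _) 1≤k n with k ℕ.≤? n
... | no  k≰n         = trans (S1Y-above g g0≡0 (ℕ.≰⇒> k≰n)) (sym (rhsCoeff-above A (ℕ.≰⇒> k≰n)))
... | yes k≤n@(s≤s _) = trans (S1Y-closedForm isProbLog isA2 1≤k k≤n) (sym (rhsCoeff-≤ A k≤n))
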